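{- Let $\Gamma$ be a maximal $\mathbb{SKHM}$-consistent set and $\mathcal{M}^c_\Gamma=(S^c,R^c,V^c)$ its canonical model. For each $\Delta\in\Phi_\Gamma$ there exists $w\in S^c$ with $L(w)=\Delta$.
   Context: Formulas: $\phi::=p\mid\neg\phi\mid(\phi\wedge\phi)\mid \mathcal{K}hm(\phi,\phi,\phi)$ over countable $\mathbf{P}$; $\mathcal{U}\phi$ abbreviates $\mathcal{K}hm(\neg\phi,\top,\bot)$. The system $\mathbb{SKHM}$ (with $p,q,r,o,p',q',o'$ proposition letters) has axioms: TAUT all propositional tautologies; DISTU $\mathcal{U}p\wedge\mathcal{U}(p\to q)\to\mathcal{U}q$; TU $\mathcal{U}p\to p$; 4KhmU $\mathcal{K}hm(p,o,q)\to\mathcal{U}\mathcal{K}hm(p,o,q)$; 5KhmU $\neg\mathcal{K}hm(p,o,q)\to\mathcal{U}\neg\mathcal{K}hm(p,o,q)$; EMPKhm $\mathcal{U}(p\to q)\to\mathcal{K}hm(p,\bot,q)$; COMPKhm $\mathcal{K}hm(p,o,r)\wedge\mathcal{K}hm(r,o,q)\wedge\mathcal{U}(r\to o)\to\mathcal{K}hm(p,o,q)$; ONEKhm $\mathcal{K}hm(p,o,q)\wedge\neg\mathcal{K}hm(p,\bot,q)\to\mathcal{K}hm(p,\bot,o)$; UKhm $\mathcal{U}(p'\to p)\wedge\mathcal{U}(o\to o')\wedge\mathcal{U}(q\to q')\wedge\mathcal{K}hm(p,o,q)\to\mathcal{K}hm(p',o',q')$; rules MP, NECU, SUB. Canonical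 model: $\Phi_\Gamma$ is the set of maximal consistent $\Delta$ containing exactly the same $\mathcal{K}hm$-formulas as $\Gamma$. $\Sigma_\Gamma=\{\langle\psi,\bot,\phi\rangle\mid\mathcal{K}hm(\psi,\bot,\phi)\in\Gamma\}\cup\{\langle\chi^\psi,\phi\rangle\mid\mathcal{K}hm(\psi,\chi,\phi)\in\Gamma,\ \neg\mathcal{K}hm(\psi,\bot,\phi)\in\Gamma\}$ (formal symbols; $\chi^\psi$ is a formal marker). $S^c$ is the set of pairs $w=(\Delta,\chi^\psi)$ with $\chi\in\Delta\in\Phi_\Gamma$ such that $\langle\chi^\psi,\phi\rangle\in\Sigma_\Gamma$ for some $\phi$ or $\langle\psi,\bot,\chi\rangle\in\Sigma_\Gamma$; $L(w)=\Delta$, $R(w)=\chi^\psi$. Transitions: $w\xrightarrow{\langle\psi,\bot,\phi\rangle}w'$ iff $\psi\in L(w)$ and $R(w')=\phi^\psi$; $w\xrightarrow{\langle\chi^\psi,\phi\rangle}w'$ iff $R(w)=\chi^\psi$ and $\phi\in L(w')$; $p\in V^c(w)$ iff $p\in L(w)$. -}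

module Defs where

open import Data.Nat using (ℕ)
open import Data.Bool using (Bool; true; false; not; _∧_)
open import Data.List using (List; []; _∷_)
open import Data.List.Relation.Unary.All using (All)
open import Data.Product using (Σ; _×_; ∃)
open import Data.Sum using (_⊎_)
open import Relation.Binary.PropositionalEquality using (_≡_)
open import Relation.Nullary using (¬_)

data Fm : Set where
  var : ℕ → Fm
  ~_  : Fm → Fm
  _∧'_ : Fm → Fm → Fm
  Khm : Fm → Fm → Fm → Fm

infixr 6 _∧'_
infixr 4 _⇒_

⊥' : Fm
⊥' = var 0 ∧' ~ var 0

⊤' : Fm
⊤' = ~ ⊥'

_⇒_ : Fm → Fm → Fm
φ ⇒ ψ = ~ (φ ∧' ~ ψ)

U : Fm → Fm
U φ = Khm (~ φ) ⊤' ⊥'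

-- Propositional tautologies: true under every Boolean valuation
-- of the propositional atoms, treating Khm-formulas as atoms.
eval : (Fm → Bool) → Fm → Bool
eval v (var n) = v (var n)
eval v (~ φ) = not (eval v φ)
eval v (φ ∧' ψ) = eval v φ ∧ eval v ψ
eval v (Khm a b c) = v (Khm a b c)

Tautology : Fm → Set
Tautology φ = ∀ (v : Fm → Bool) → eval v φ ≡ true

sub : (ℕ → Fm) → Fm → Fm
sub σ (var n) = σ n
sub σ (~ φ) = ~ sub σ φ
sub σ (φ ∧' ψ) = sub σ φ ∧' sub σ ψ
sub σ (Khm a b c) = Khm (sub σ a) (sub σ b) (sub σ c)

p q r o p' q' o' : Fm
p = var 1
q = var 2
r = var 3
o = var 4
p' = var 5
q' = var 6
o' = var 7

data ⊢_ : Fm → Set where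
  TAUT  : ∀ {φ} → Tautology φ → ⊢ φ
  DISTU : ⊢ (U p ∧' U (p ⇒ q) ⇒ U q)
  TU    : ⊢ (U p ⇒ p)
  4KhmU : ⊢ (Khm p o q ⇒ U (Khm p o q))
  5KhmU : ⊢ (~ Khm p o q ⇒ U (~ Khm p o q))
  EMPKhm : ⊢ (U (p ⇒ q) ⇒ Khm p ⊥' q)
  COMPKhm : ⊢ (Khm p o r ∧' Khm r o q ∧' U (r ⇒ o) ⇒ Khm p o q)
  ONEKhm : ⊢ (Khm p o q ∧' ~ Khm p ⊥' q ⇒ Khm p ⊥' o)
  UKhm  : ⊢ (U (p' ⇒ p) ∧' U (o ⇒ o') ∧' U (q ⇒ q') ∧' Khm p o q ⇒ Khm p' o' q')
  MP    : ∀ {φ ψ} → ⊢ (φ ⇒ ψ) → ⊢ φ → ⊢ ψ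
  NECU  : ∀ {φ} → ⊢ φ → ⊢ U φ
  SUB   : ∀ {φ} (σ : ℕ → Fm) → ⊢ φ → ⊢ sub σ φ

FmSet : Set
FmSet = Fm → Bool

_∈_ : Fm → FmSet → Set
φ ∈ Γ = Γ φ ≡ true

conj : List Fm → Fm
conj [] = ⊤'
conj (φ ∷ φs) = φ ∧' conj φs

Consistent : FmSet → Set
Consistent Γ = ¬ (Σ (List Fm) λ φs → All (_∈ Γ) φs × (⊢ ~ conj φs))

-- Γ ∪ {φ} is consistent (membership in Γ ∪ {φ}: ψ ∈ Γ or ψ ≡ φ)
ConsistentWith : FmSet → Fm → Set
ConsistentWith Γ φ =
  ¬ (Σ (List Fm) λ φs → All (λ ψ → ψ ∈ Γ ⊎ ψ ≡ φ) φs × (⊢ ~ conj φs))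

MCS : FmSet → Set
MCS Γ = Consistent Γ × (∀ φ → Γ φ ≡ false → ¬ ConsistentWith Γ φ)

InΦ : FmSet → FmSet → Set
InΦ Γ Δ = MCS Δ × (∀ a b c → (Khm a b c ∈ Δ → Khm a b c ∈ Γ) × (Khm a b c ∈ Γ → Khm a b c ∈ Δ))

-- Candidate states w = (Δ, χ^ψ); the formal marker χ^ψ is the pair (χ , ψ)
record State : Set where
  constructor ⟨_,_^_⟩
  field
    L : FmSet
    Rχ : Fm
    Rψ : Fm
open State public

InΣmark : FmSet → Fm → Fm → Fm → Set
InΣmark Γ χ ψ φ = Khm ψ χ φ ∈ Γ × (~ Khm ψ ⊥' φ) ∈ Γ

InΣbot : FmSet → Fm → Fm → Set
InΣbot Γ ψ φ = Khm ψ ⊥' φ ∈ Γ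

InS : FmSet → State → Set
InS Γ w = InΦ Γ (L w) × Rχ w ∈ L w
        × ((Σ Fm λ φ → InΣmark Γ (Rχ w) (Rψ w) φ) ⊎ InΣbot Γ (Rψ w) (Rχ w))

module Submission where

-- Every Δ ∈ Φ_Γ carries the state (Δ, ⊤^⊤): ⊤ lies in every maximal consistent
-- set, and Khm(⊤, ⊥, ⊤) follows from EMPKhm by necessitation of ⊤ → ⊤, so it is
-- in Γ and ⟨⊤, ⊥, ⊤⟩ ∈ Σ_Γ.

open import Defs
open import Data.Bool using (true; false; not; _∧_)
open import Data.Bool.Properties using (∧-inverseʳ)
open import Data.Empty using (⊥-elim)
open import Data.List using (List; []; _∷_)
open import Data.List.Relation.Unary.All using (All; []; _∷_)
open import Data.Nat using (ℕ)
open import Data.Product using (Σ; _×_; _,_; proj₁)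
open import Data.Sum using (_⊎_; inj₁; inj₂)
open import Relation.Binary.PropositionalEquality using (_≡_; refl; cong)

∧-true⁺ : ∀ {a b} → a ≡ true → b ≡ true → a ∧ b ≡ true
∧-true⁺ refl refl = refl

∧-true⁻ : ∀ {a b} → a ∧ b ≡ true → a ≡ true × b ≡ true
∧-true⁻ {true} b≡true = refl , b≡true

implication-true : ∀ {a b} → (a ≡ true → b ≡ true) → not (a ∧ not b) ≡ true
implication-true {false}        _   = refl
implication-true {true} {true}  _   = refl
implication-true {true} {false} a⇒b with a⇒b refl
... | ()

not-antitone : ∀ {a b} → (b ≡ true → a ≡ true) → not a ≡ true → not b ≡ true
not-antitone {false} {false} _   _ = refl
not-antitone {false} {true}  b⇒a _ with b⇒a refl
... | ()

⇒-holds : ∀ v φ ψ → (eval v φ ≡ true → eval v ψ ≡ true) → eval v (φ ⇒ ψ) ≡ true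
⇒-holds v φ ψ = implication-true {eval v φ} {eval v ψ}

eval-⊤ : ∀ v → eval v ⊤' ≡ true
eval-⊤ v = cong not (∧-inverseʳ (v (var 0)))

⊢-∧-intro : ∀ {φ ψ} → ⊢ φ → ⊢ ψ → ⊢ (φ ∧' ψ)
⊢-∧-intro {φ} {ψ} ⊢φ ⊢ψ = MP (MP (TAUT pairing) ⊢φ) ⊢ψ
  where
  pairing : Tautology (φ ⇒ (ψ ⇒ (φ ∧' ψ)))
  pairing v = ⇒-holds v φ (ψ ⇒ (φ ∧' ψ)) λ φ-true → ⇒-holds v ψ (φ ∧' ψ) (∧-true⁺ φ-true)

Khm-⊥-intro : ∀ ψ χ → ⊢ U (ψ ⇒ χ) → ⊢ Khm ψ ⊥' χ
Khm-⊥-intro ψ χ = MP (SUB instantiate EMPKhm)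
  where
  instantiate : ℕ → Fm
  instantiate 1 = ψ
  instantiate 2 = χ
  instantiate n = var n

⊢Khm-⊤⊥⊤ : ⊢ Khm ⊤' ⊥' ⊤'
⊢Khm-⊤⊥⊤ = Khm-⊥-intro ⊤' ⊤' (NECU (TAUT λ v → ⇒-holds v ⊤' ⊤' λ ⊤-true → ⊤-true))

module _ {P : Fm → Set} {φ : Fm} where

  dropAdded : (φs : List Fm) → All (λ ψ → P ψ ⊎ ψ ≡ φ) φs → List Fm
  dropAdded []       []            = []
  dropAdded (ψ ∷ φs) (inj₁ _ ∷ φs⊆) = ψ ∷ dropAdded φs φs⊆
  dropAdded (_ ∷ φs) (inj₂ _ ∷ φs⊆) = dropAdded φs φs⊆

  dropAdded-All : (φs : List Fm) (φs⊆ : All (λ ψ → P ψ ⊎ ψ ≡ φ) φs) → All P (dropAdded φs φs⊆)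
  dropAdded-All []       []              = []
  dropAdded-All (_ ∷ φs) (inj₁ Pψ ∷ φs⊆) = Pψ ∷ dropAdded-All φs φs⊆
  dropAdded-All (_ ∷ φs) (inj₂ _  ∷ φs⊆) = dropAdded-All φs φs⊆

  eval-conj-dropAdded : ∀ v → eval v φ ≡ true → (φs : List Fm) (φs⊆ : All (λ ψ → P ψ ⊎ ψ ≡ φ) φs) →
                        eval v (conj (dropAdded φs φs⊆)) ≡ true → eval v (conj φs) ≡ true
  eval-conj-dropAdded v φ-true []       []                 rest-true = rest-true
  eval-conj-dropAdded v φ-true (_ ∷ φs) (inj₁ _    ∷ φs⊆) rest-true =
    let ψ-true , φs-true = ∧-true⁻ rest-true
    in ∧-true⁺ ψ-true (eval-conj-dropAdded v φ-true φs φs⊆ φs-true)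
  eval-conj-dropAdded v φ-true (_ ∷ φs) (inj₂ refl ∷ φs⊆) rest-true =
    ∧-true⁺ φ-true (eval-conj-dropAdded v φ-true φs φs⊆ rest-true)

  refute-dropAdded : ∀ φs (φs⊆ : All (λ ψ → P ψ ⊎ ψ ≡ φ) φs) →
                     Tautology ((φ ∧' ~ conj φs) ⇒ ~ conj (dropAdded φs φs⊆))
  refute-dropAdded φs φs⊆ v = ⇒-holds v (φ ∧' ~ conj φs) (~ conj (dropAdded φs φs⊆)) λ premise-true →
    let φ-true , ¬φs-true = ∧-true⁻ premise-true
    in not-antitone (eval-conj-dropAdded v φ-true φs φs⊆) ¬φs-true

-- A refutation of Γ ∪ {φ} with ⊢ φ becomes a refutation of Γ once the copies of φ are dropped.
MCS-closed : ∀ {Γ φ} → MCS Γ → ⊢ φ → φ ∈ Γ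
MCS-closed {Γ} {φ} (consistent , maximal) ⊢φ with Γ φ in φ∉Γ
... | true  = refl
... | false = ⊥-elim (maximal φ φ∉Γ λ (φs , φs⊆ , ⊢¬⋀φs) →
  consistent (dropAdded φs φs⊆ , dropAdded-All φs φs⊆ ,
              MP (TAUT (refute-dropAdded φs φs⊆)) (⊢-∧-intro ⊢φ ⊢¬⋀φs)))

proposition9 : (Γ : FmSet) → MCS Γ → (Δ : FmSet) → InΦ Γ Δ →
    Σ State (λ w → InS Γ w × L w ≡ Δ)
proposition9 Γ mcsΓ Δ Δ∈Φ =
  ⟨ Δ , ⊤' ^ ⊤' ⟩ ,
  (Δ∈Φ , MCS-closed (proj₁ Δ∈Φ) (TAUT eval-⊤) , inj₂ (MCS-closed mcsΓ ⊢Khm-⊤⊥⊤)) ,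
  refl
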